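{- Let $G=(V,E)$ be a finite simple regular graph with $p=|V|$ vertices and $q=|E|$ edges. If $x$ is any easy construction sequence for $G$, then $\nu(x)=\nu^*(G)=q(p+q)$.
   Context: For a finite simple graph $G=(V,E)$ with $p=|V|$, $q=|E|$, $\ell=p+q$, a construction sequence (c-sequence) for $G$ is a bijection $x:\{1,\dots,\ell\}\to V\sqcup E$ such that for every edge $e=uw$, $x^{ -1}(e)>\max\{x^{ -1}(u),x^{ -1}(w)\}$. The cost of an edge $e=uw$ in $x$ is $\nu(e,x)=(x^{ -1}(e)-x^{ -1}(u))+(x^{ -1}(e)-x^{ -1}(w))$, and the cost of $x$ is $\nu(x)=\sum_{e\in E}\nu(e,x)$. The max cost of $G$ is $\nu^*(G)=\max\nu(x)$ over all c-sequences $x$ for $G$. A c-sequence is easy if every vertex appears before every edge (i.e. $x(1),\dots,x(p)$ are the vertices). -}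

module Defs where

open import Data.Nat using (ℕ; zero; suc; _+_; _*_; _∸_; _≤_; _<_)
open import Data.Fin using (Fin; toℕ; _≟_)
import Data.Fin as F
open import Data.Product using (_×_; _,_; proj₁; proj₂; Σ; ∃)
open import Data.Sum using (_⊎_; inj₁; inj₂)
open import Data.Bool using (Bool; true; false; if_then_else_; _∨_)
open import Relation.Nullary using (¬_)
open import Relation.Nullary.Decidable using (⌊_⌋)
open import Relation.Binary.PropositionalEquality using (_≡_; _≢_)
open import Function.Bundles using (_↔_; Inverse)

sumFin : (n : ℕ) → (Fin n → ℕ) → ℕ
sumFin zero    f = 0
sumFin (suc n) f = f F.zero + sumFin n (λ i → f (F.suc i))

record Graph : Set where
  field
    p    : ℕ
    q    : ℕ
    ends : Fin q → Fin p × Fin p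
    loopless : ∀ e → proj₁ (ends e) ≢ proj₂ (ends e)
    noMulti  : ∀ e f →
      ((proj₁ (ends e) ≡ proj₁ (ends f) × proj₂ (ends e) ≡ proj₂ (ends f))
       ⊎ (proj₁ (ends e) ≡ proj₂ (ends f) × proj₂ (ends e) ≡ proj₁ (ends f)))
      → e ≡ f

open Graph public

degree : (G : Graph) → Fin (p G) → ℕ
degree G v = sumFin (q G) (λ e →
  if ⌊ v ≟ proj₁ (ends G e) ⌋ ∨ ⌊ v ≟ proj₂ (ends G e) ⌋ then 1 else 0)

Regular : Graph → Set
Regular G = ∃ λ k → ∀ v → degree G v ≡ k

Elem : Graph → Set
Elem G = Fin (p G) ⊎ Fin (q G)

-- A bijection x : {1..ℓ} → V ⊔ E (positions are 0-based here;
-- only differences of positions matter).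
Seq : Graph → Set
Seq G = Fin (p G + q G) ↔ Elem G

pos : (G : Graph) → Seq G → Elem G → ℕ
pos G x a = toℕ (Inverse.from x a)

IsCSeq : (G : Graph) → Seq G → Set
IsCSeq G x = ∀ e →
  (pos G x (inj₁ (proj₁ (ends G e))) < pos G x (inj₂ e)) ×
  (pos G x (inj₁ (proj₂ (ends G e))) < pos G x (inj₂ e))

IsEasy : (G : Graph) → Seq G → Set
IsEasy G x = ∀ v e → pos G x (inj₁ v) < pos G x (inj₂ e)

edgeCost : (G : Graph) → Seq G → Fin (q G) → ℕ
edgeCost G x e =
  (pos G x (inj₂ e) ∸ pos G x (inj₁ (proj₁ (ends G e)))) +
  (pos G x (inj₂ e) ∸ pos G x (inj₁ (proj₂ (ends G e))))

cost : (G : Graph) → Seq G → ℕ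
cost G x = sumFin (q G) (edgeCost G x)

IsMaxCost : Graph → ℕ → Set
IsMaxCost G m =
  (Σ (Seq G) λ x → IsCSeq G x × cost G x ≡ m) ×
  (∀ (x : Seq G) → IsCSeq G x → cost G x ≤ m)

-- Write S and V for the sums of the positions of the edges and of the vertices in a
-- c-sequence. An edge uw costs 2·pos(e) − pos(u) − pos(w), and in a k-regular graph every
-- vertex is an endpoint of exactly k edges, so the cost is 2S − kV. Since S + V is the fixed
-- number T = 0 + 1 + ⋯ + (p + q − 1), the cost equals (2 + k)S − kT and grows with S. Now q
-- distinct positions sum to at most the top q positions, with equality when the edges come
-- last, as in an easy sequence; evaluating there with kp = 2q gives q(p + q).
module Submission where

open import Defs
open import Data.Nat using (ℕ; _+_; _*_)
open import Data.Product using (_×_)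
open import Relation.Binary.PropositionalEquality using (_≡_)

open import Data.Nat using (zero; suc; _∸_; _≤_; _<_; z≤n; s≤s)
open import Data.Nat.Properties hiding (_≟_)
open import Data.Nat.Tactic.RingSolver using (solve; solve-∀)
open import Data.Fin as Fin using (Fin; toℕ; _≟_; splitAt)
open import Data.Fin.Properties using (+↔⊎)
open import Data.List using (_∷_; [])
open import Data.Product using (_,_; proj₁; proj₂)
open import Data.Sum using (_⊎_; inj₁; inj₂; [_,_]′)
import Data.Sum as Sum
open import Data.Bool using (Bool; true; false; if_then_else_; _∨_)
open import Data.Empty using (⊥-elim)
open import Algebra.Properties.CommutativeSemigroup +-commutativeSemigroup using (interchange)
open import Function using (_∘_; const)
open import Relation.Nullary using (yes; no)
open import Relation.Nullary.Decidable using (⌊_⌋)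
open import Relation.Binary.PropositionalEquality
  using (refl; sym; trans; subst; subst₂; cong; cong₂; _≢_; module ≡-Reasoning)
open import Function.Bundles using (_↔_; Inverse)
open import Function.Construct.Composition using (_↔-∘_)
open import Function.Construct.Symmetry using (↔-sym)
open import Algebra.Properties.Semiring.Sum +-*-semiring
  using (sum-syntax; sum-cong-≗; ∑-distrib-+; ∑-comm; sum-permute; *-distribˡ-sum)

sumFin≡∑ : ∀ n (f : Fin n → ℕ) → sumFin n f ≡ ∑[ i < n ] f i
sumFin≡∑ zero    f = refl
sumFin≡∑ (suc n) f = cong (f Fin.zero +_) (sumFin≡∑ n (f ∘ Fin.suc))

∑-const : ∀ n c → ∑[ i < n ] c ≡ n * c
∑-const zero    c = refl
∑-const (suc n) c = cong (c +_) (∑-const n c)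

∑-zero : ∀ {n} (f : Fin n → ℕ) → (∀ i → f i ≡ 0) → ∑[ i < n ] f i ≡ 0
∑-zero {n} f f≡0 = trans (sum-cong-≗ f≡0) (trans (∑-const n 0) (*-zeroʳ n))

∑-splitAt : ∀ m n (h : Fin m ⊎ Fin n → ℕ) →
  ∑[ i < m + n ] h (splitAt m i) ≡ ∑[ i < m ] h (inj₁ i) + ∑[ j < n ] h (inj₂ j)
∑-splitAt zero    n h = refl
∑-splitAt (suc m) n h =
  trans (cong (h (inj₁ Fin.zero) +_) (∑-splitAt m n (h ∘ Sum.map₁ Fin.suc)))
        (sym (+-assoc (h (inj₁ Fin.zero)) _ _))

∑-↔⊎ : ∀ {m n} (y : Fin (m + n) ↔ (Fin m ⊎ Fin n)) (h : Fin m ⊎ Fin n → ℕ) →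
  ∑[ i < m + n ] h (Inverse.to y i) ≡ ∑[ i < m ] h (inj₁ i) + ∑[ j < n ] h (inj₂ j)
∑-↔⊎ {m} {n} y h = begin
  ∑[ i < m + n ] h (Inverse.to y i)
    ≡⟨ sum-permute (h ∘ Inverse.to y) (↔-sym y ↔-∘ +↔⊎) ⟩
  ∑[ i < m + n ] h (Inverse.to y (Inverse.from y (splitAt m i)))
    ≡⟨ sum-cong-≗ (λ i → cong h (Inverse.strictlyInverseˡ y (splitAt m i))) ⟩
  ∑[ i < m + n ] h (splitAt m i)
    ≡⟨ ∑-splitAt m n h ⟩
  ∑[ i < m ] h (inj₁ i) + ∑[ j < n ] h (inj₂ j) ∎
  where open ≡-Reasoning

triangle : ℕ → ℕ
triangle n = ∑[ i < n ] toℕ i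

triangle-suc : ∀ n → triangle (suc n) ≡ n + triangle n
triangle-suc n = trans (∑-distrib-+ {n} (const 1) toℕ)
                       (cong (_+ triangle n) (trans (∑-const n 1) (*-identityʳ n)))

triangle-double : ∀ n → triangle n + triangle n + n ≡ n * n
triangle-double zero    = refl
triangle-double (suc n) = begin
  triangle (suc n) + triangle (suc n) + suc n
    ≡⟨ cong (λ t → t + t + suc n) (triangle-suc n) ⟩
  (n + triangle n) + (n + triangle n) + suc n
    ≡⟨ regroup n (triangle n) ⟩
  (triangle n + triangle n + n) + (suc n + n)
    ≡⟨ cong (_+ (suc n + n)) (triangle-double n) ⟩
  n * n + (suc n + n)
    ≡⟨ solve (n ∷ []) ⟩
  suc n * suc n ∎
  where
  open ≡-Reasoning
  regroup : ∀ n t → (n + t) + (n + t) + suc n ≡ (t + t + n) + (suc n + n)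
  regroup = solve-∀

indicator : Bool → ℕ
indicator b = if b then 1 else 0

indicator≤1 : ∀ b → indicator b ≤ 1
indicator≤1 true  = s≤s z≤n
indicator≤1 false = z≤n

indicator-≟-∨ : ∀ {n} (i j k : Fin n) → j ≢ k →
  indicator (⌊ i ≟ j ⌋ ∨ ⌊ i ≟ k ⌋) ≡ indicator ⌊ i ≟ j ⌋ + indicator ⌊ i ≟ k ⌋
indicator-≟-∨ i j k j≢k with i ≟ j | i ≟ k
... | yes refl | yes refl = ⊥-elim (j≢k refl)
... | yes _    | no _     = refl
... | no _     | _        = refl

⌊suc≟suc⌋ : ∀ {n} (i j : Fin n) → ⌊ Fin.suc i ≟ Fin.suc j ⌋ ≡ ⌊ i ≟ j ⌋
⌊suc≟suc⌋ i j with i ≟ j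
... | yes _ = refl
... | no  _ = refl

∑-indicator-≟ : ∀ n (g : Fin n → ℕ) j → ∑[ i < n ] (g i * indicator ⌊ i ≟ j ⌋) ≡ g j
∑-indicator-≟ (suc n) g Fin.zero = begin
  g Fin.zero * 1 + ∑[ i < n ] (g (Fin.suc i) * 0)
    ≡⟨ cong₂ _+_ (*-identityʳ _) (∑-zero _ (λ i → *-zeroʳ (g (Fin.suc i)))) ⟩
  g Fin.zero + 0
    ≡⟨ +-identityʳ _ ⟩
  g Fin.zero ∎
  where open ≡-Reasoning
∑-indicator-≟ (suc n) g (Fin.suc j) = begin
  g Fin.zero * 0 + ∑[ i < n ] (g (Fin.suc i) * indicator ⌊ Fin.suc i ≟ Fin.suc j ⌋)
    ≡⟨ cong₂ _+_ (*-zeroʳ (g Fin.zero))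
                 (sum-cong-≗ (λ i → cong (λ b → g (Fin.suc i) * indicator b) (⌊suc≟suc⌋ i j))) ⟩
  ∑[ i < n ] (g (Fin.suc i) * indicator ⌊ i ≟ j ⌋)
    ≡⟨ ∑-indicator-≟ n (g ∘ Fin.suc) j ⟩
  g (Fin.suc j) ∎
  where open ≡-Reasoning

module _ (G : Graph) where

  end₁ end₂ : Fin (q G) → Fin (p G)
  end₁ e = proj₁ (ends G e)
  end₂ e = proj₂ (ends G e)

  handshake : (g : Fin (p G) → ℕ) →
    ∑[ e < q G ] (g (end₁ e) + g (end₂ e)) ≡ ∑[ v < p G ] (g v * degree G v)
  handshake g = sym (begin
    ∑[ v < p G ] (g v * degree G v)
      ≡⟨ sum-cong-≗ (λ v → cong (g v *_) (sumFin≡∑ (q G) (incidence v))) ⟩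
    ∑[ v < p G ] (g v * ∑[ e < q G ] incidence v e)
      ≡⟨ sum-cong-≗ (λ v → *-distribˡ-sum (g v) (incidence v)) ⟩
    ∑[ v < p G ] ∑[ e < q G ] (g v * incidence v e)
      ≡⟨ ∑-comm (λ v e → g v * incidence v e) ⟩
    ∑[ e < q G ] ∑[ v < p G ] (g v * incidence v e)
      ≡⟨ sum-cong-≗ endpoint-terms ⟩
    ∑[ e < q G ] (g (end₁ e) + g (end₂ e)) ∎)
    where
    open ≡-Reasoning
    incidence : Fin (p G) → Fin (q G) → ℕ
    incidence v e = indicator (⌊ v ≟ end₁ e ⌋ ∨ ⌊ v ≟ end₂ e ⌋)
    endpoint-terms : ∀ e → ∑[ v < p G ] (g v * incidence v e) ≡ g (end₁ e) + g (end₂ e)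
    endpoint-terms e = begin
      ∑[ v < p G ] (g v * incidence v e)
        ≡⟨ sum-cong-≗ (λ v → trans (cong (g v *_) (indicator-≟-∨ v (end₁ e) (end₂ e) (loopless G e)))
                                   (*-distribˡ-+ (g v) _ _)) ⟩
      ∑[ v < p G ] (at₁ v + at₂ v)
        ≡⟨ ∑-distrib-+ at₁ at₂ ⟩
      ∑[ v < p G ] at₁ v + ∑[ v < p G ] at₂ v
        ≡⟨ cong₂ _+_ (∑-indicator-≟ (p G) g (end₁ e)) (∑-indicator-≟ (p G) g (end₂ e)) ⟩
      g (end₁ e) + g (end₂ e) ∎
      where
      at₁ at₂ : Fin (p G) → ℕ
      at₁ v = g v * indicator ⌊ v ≟ end₁ e ⌋
      at₂ v = g v * indicator ⌊ v ≟ end₂ e ⌋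

  regular-handshake : ∀ {k} → (∀ v → degree G v ≡ k) → k * p G ≡ q G + q G
  regular-handshake {k} regular = begin
    k * p G                           ≡⟨ *-comm k (p G) ⟩
    p G * k                           ≡⟨ ∑-const (p G) k ⟨
    ∑[ v < p G ] k                    ≡⟨ sum-cong-≗ (λ v → trans (*-identityˡ (degree G v)) (regular v)) ⟨
    ∑[ v < p G ] (1 * degree G v)     ≡⟨ handshake (const 1) ⟨
    ∑[ e < q G ] 2                    ≡⟨ ∑-const (q G) 2 ⟩
    q G * 2                           ≡⟨ *-comm (q G) 2 ⟩
    2 * q G                           ≡⟨ cong (q G +_) (+-identityʳ (q G)) ⟩
    q G + q G                         ∎
    where open ≡-Reasoning

count weight : ∀ {n} → (Fin n → Bool) → ℕ
count  {n} b = ∑[ i < n ] indicator (b i)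
weight {n} b = ∑[ i < n ] (toℕ i * indicator (b i))

count≤ : ∀ n (b : Fin n → Bool) → count b ≤ n
count≤ zero    b = z≤n
count≤ (suc n) b = +-mono-≤ (indicator≤1 (b Fin.zero)) (count≤ n (b ∘ Fin.suc))

weight-suc : ∀ n (b : Fin (suc n) → Bool) →
  weight b ≡ count (b ∘ Fin.suc) + weight (b ∘ Fin.suc)
weight-suc n b = ∑-distrib-+ (indicator ∘ b ∘ Fin.suc) (λ i → toℕ i * indicator (b (Fin.suc i)))

UpwardClosed : ∀ {n} → (Fin n → Bool) → Set
UpwardClosed b = ∀ {i j} → i Fin.≤ j → b i ≡ true → b j ≡ true

private
  shift-head : ∀ c w t → (c + w) + t + c ≡ c + (w + t + c)
  shift-head = solve-∀

  shift-head-suc : ∀ c w t → (c + w) + (c + t) + suc c ≡ (w + t + c) + (c + suc c)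
  shift-head-suc = solve-∀

  *-suc-suc : ∀ c n → c * n + (c + suc n) ≡ suc c * suc n
  *-suc-suc = solve-∀

-- c n − (triangle c + c) is the sum of the top c positions n − c, …, n − 1.
weight-bound : ∀ n (b : Fin n → Bool) → weight b + triangle (count b) + count b ≤ count b * n
weight-bound zero    b = z≤n
weight-bound (suc n) b =
  subst (λ w → w + triangle (count b) + count b ≤ count b * suc n) (sym (weight-suc n b))
        (step (b Fin.zero))
  where
  open ≤-Reasoning
  c = count (b ∘ Fin.suc)
  w = weight (b ∘ Fin.suc)
  step : ∀ h →
    (c + w) + triangle (indicator h + c) + (indicator h + c) ≤ (indicator h + c) * suc n
  step false = begin
    (c + w) + triangle c + c   ≡⟨ shift-head c w (triangle c) ⟩
    c + (w + triangle c + c)   ≤⟨ +-monoʳ-≤ c (weight-bound n (b ∘ Fin.suc)) ⟩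
    c + c * n                  ≡⟨ *-suc c n ⟨
    c * suc n                  ∎
  step true = begin
    (c + w) + triangle (suc c) + suc c   ≡⟨ cong (λ t → (c + w) + t + suc c) (triangle-suc c) ⟩
    (c + w) + (c + triangle c) + suc c   ≡⟨ shift-head-suc c w (triangle c) ⟩
    (w + triangle c + c) + (c + suc c)   ≤⟨ +-mono-≤ (weight-bound n (b ∘ Fin.suc))
                                                    (+-monoʳ-≤ c (s≤s (count≤ n (b ∘ Fin.suc)))) ⟩
    c * n + (c + suc n)                  ≡⟨ *-suc-suc c n ⟩
    suc c * suc n                        ∎

weight-upwardClosed : ∀ n (b : Fin n → Bool) → UpwardClosed b →
  weight b + triangle (count b) + count b ≡ count b * n
weight-upwardClosed zero    b up = refl
weight-upwardClosed (suc n) b up =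
  trans (cong (λ w → w + triangle (count b) + count b) (weight-suc n b)) (step (b Fin.zero) refl)
  where
  open ≡-Reasoning
  c = count (b ∘ Fin.suc)
  w = weight (b ∘ Fin.suc)
  IH : w + triangle c + c ≡ c * n
  IH = weight-upwardClosed n (b ∘ Fin.suc) (λ i≤j → up (s≤s i≤j))
  step : ∀ h → b Fin.zero ≡ h →
    (c + w) + triangle (indicator h + c) + (indicator h + c) ≡ (indicator h + c) * suc n
  step false _ = begin
    (c + w) + triangle c + c   ≡⟨ shift-head c w (triangle c) ⟩
    c + (w + triangle c + c)   ≡⟨ cong (c +_) IH ⟩
    c + c * n                  ≡⟨ *-suc c n ⟨
    c * suc n                  ∎
  step true b₀ = begin
    (c + w) + triangle (suc c) + suc c   ≡⟨ cong (λ t → (c + w) + t + suc c) (triangle-suc c) ⟩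
    (c + w) + (c + triangle c) + suc c   ≡⟨ shift-head-suc c w (triangle c) ⟩
    (w + triangle c + c) + (c + suc c)   ≡⟨ cong₂ (λ x m → x + (c + suc m)) IH c≡n ⟩
    c * n + (c + suc n)                  ≡⟨ *-suc-suc c n ⟩
    suc c * suc n                        ∎
    where
    c≡n : c ≡ n
    c≡n = trans (sum-cong-≗ {n} {y = const 1} (λ i → cong indicator (up z≤n b₀)))
                (trans (∑-const n 1) (*-identityʳ n))

module _ (G : Graph) (y : Seq G) where

  private
    N = p G + q G

  vertexPositionSum edgePositionSum : ℕ
  vertexPositionSum = ∑[ v < p G ] pos G y (inj₁ v)
  edgePositionSum   = ∑[ e < q G ] pos G y (inj₂ e)

  isEdge : Elem G → Bool
  isEdge = [ const false , const true ]′

  edgeIndicator : Fin N → Bool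
  edgeIndicator i = isEdge (Inverse.to y i)

  pos-to : ∀ i → pos G y (Inverse.to y i) ≡ toℕ i
  pos-to i = cong toℕ (Inverse.strictlyInverseʳ y i)

  ∑-over-positions : (f : ℕ → Elem G → ℕ) →
    ∑[ i < N ] f (toℕ i) (Inverse.to y i)
      ≡ ∑[ v < p G ] f (pos G y (inj₁ v)) (inj₁ v)
        + ∑[ e < q G ] f (pos G y (inj₂ e)) (inj₂ e)
  ∑-over-positions f =
    trans (sum-cong-≗ (λ i → cong (λ n → f n (Inverse.to y i)) (sym (pos-to i))))
          (∑-↔⊎ y (λ a → f (pos G y a) a))

  positionSums : vertexPositionSum + edgePositionSum ≡ triangle N
  positionSums = sym (∑-over-positions (λ n _ → n))

  weight-edgeIndicator : weight edgeIndicator ≡ edgePositionSum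
  weight-edgeIndicator = trans (∑-over-positions (λ n a → n * indicator (isEdge a)))
    (cong₂ _+_ (∑-zero _ (λ v → *-zeroʳ (pos G y (inj₁ v))))
               (sum-cong-≗ (λ e → *-identityʳ (pos G y (inj₂ e)))))

  count-edgeIndicator : count edgeIndicator ≡ q G
  count-edgeIndicator = trans (∑-over-positions (λ _ a → indicator (isEdge a)))
    (cong₂ _+_ (trans (∑-const (p G) 0) (*-zeroʳ (p G)))
               (trans (∑-const (q G) 1) (*-identityʳ (q G))))

  easy⇒upwardClosed : IsEasy G y → UpwardClosed edgeIndicator
  easy⇒upwardClosed easy {i} {j} i≤j edge-i
    with Inverse.to y i in to-i | Inverse.to y j in to-j
  ... | inj₂ _ | inj₂ _ = refl
  ... | inj₂ e | inj₁ v =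
    ⊥-elim (<⇒≱ (subst₂ _<_ (position to-j) (position to-i) (easy v e)) i≤j)
    where
    position : ∀ {k a} → Inverse.to y k ≡ a → pos G y a ≡ toℕ k
    position {k} refl = pos-to k

  edgePositionSum-bound : edgePositionSum + triangle (q G) + q G ≤ q G * N
  edgePositionSum-bound = subst₂ (λ w c → w + triangle c + c ≤ c * N)
    weight-edgeIndicator count-edgeIndicator (weight-bound N edgeIndicator)

  edgePositionSum-easy : IsEasy G y → edgePositionSum + triangle (q G) + q G ≡ q G * N
  edgePositionSum-easy easy = subst₂ (λ w c → w + triangle c + c ≡ c * N)
    weight-edgeIndicator count-edgeIndicator
    (weight-upwardClosed N edgeIndicator (easy⇒upwardClosed easy))

  module _ {k} (regular : ∀ v → degree G v ≡ k) (cseq : IsCSeq G y) where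

    cost+k*vertexPositionSum :
      cost G y + k * vertexPositionSum ≡ edgePositionSum + edgePositionSum
    cost+k*vertexPositionSum = begin
      cost G y + k * vertexPositionSum
        ≡⟨ cong₂ _+_ (sumFin≡∑ (q G) (edgeCost G y)) (sym endpointPositions) ⟩
      ∑[ e < q G ] edgeCost G y e + ∑[ e < q G ] (pos₁ e + pos₂ e)
        ≡⟨ ∑-distrib-+ (edgeCost G y) (λ e → pos₁ e + pos₂ e) ⟨
      ∑[ e < q G ] (edgeCost G y e + (pos₁ e + pos₂ e))
        ≡⟨ sum-cong-≗ edgeCost+endpoints ⟩
      ∑[ e < q G ] (pos G y (inj₂ e) + pos G y (inj₂ e))
        ≡⟨ ∑-distrib-+ (λ e → pos G y (inj₂ e)) (λ e → pos G y (inj₂ e)) ⟩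
      edgePositionSum + edgePositionSum ∎
      where
      open ≡-Reasoning
      pos₁ pos₂ : Fin (q G) → ℕ
      pos₁ e = pos G y (inj₁ (end₁ G e))
      pos₂ e = pos G y (inj₁ (end₂ G e))
      endpointPositions : ∑[ e < q G ] (pos₁ e + pos₂ e) ≡ k * vertexPositionSum
      endpointPositions = begin
        ∑[ e < q G ] (pos₁ e + pos₂ e)
          ≡⟨ handshake G (λ v → pos G y (inj₁ v)) ⟩
        ∑[ v < p G ] (pos G y (inj₁ v) * degree G v)
          ≡⟨ sum-cong-≗ (λ v → trans (cong (pos G y (inj₁ v) *_) (regular v)) (*-comm _ k)) ⟩
        ∑[ v < p G ] (k * pos G y (inj₁ v))
          ≡⟨ *-distribˡ-sum k (λ v → pos G y (inj₁ v)) ⟨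
        k * vertexPositionSum ∎
      edgeCost+endpoints : ∀ e →
        edgeCost G y e + (pos₁ e + pos₂ e) ≡ pos G y (inj₂ e) + pos G y (inj₂ e)
      edgeCost+endpoints e =
        trans (interchange (pos G y (inj₂ e) ∸ pos₁ e) (pos G y (inj₂ e) ∸ pos₂ e) (pos₁ e) (pos₂ e))
              (cong₂ _+_ (m∸n+n≡m (<⇒≤ (proj₁ (cseq e)))) (m∸n+n≡m (<⇒≤ (proj₂ (cseq e)))))

    cost-formula : cost G y + k * triangle N ≡ (2 + k) * edgePositionSum
    cost-formula = begin
      cost G y + k * triangle N
        ≡⟨ cong (λ t → cost G y + k * t) positionSums ⟨
      cost G y + k * (vertexPositionSum + edgePositionSum)
        ≡⟨ distribute (cost G y) k vertexPositionSum edgePositionSum ⟩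
      (cost G y + k * vertexPositionSum) + k * edgePositionSum
        ≡⟨ cong (_+ k * edgePositionSum) cost+k*vertexPositionSum ⟩
      (edgePositionSum + edgePositionSum) + k * edgePositionSum
        ≡⟨ collect k edgePositionSum ⟩
      (2 + k) * edgePositionSum ∎
      where
      open ≡-Reasoning
      distribute : ∀ c k V S → c + k * (V + S) ≡ (c + k * V) + k * S
      distribute = solve-∀
      collect : ∀ k S → (S + S) + k * S ≡ (2 + k) * S
      collect = solve-∀

-- Doubled throughout, so that triangle numbers only enter through triangle-double.
easy-cost-value : ∀ {c k p q S} → k * p ≡ q + q → c + k * triangle (p + q) ≡ (2 + k) * S →
  S + triangle q + q ≡ q * (p + q) → c ≡ q * (p + q)
easy-cost-value {c} {k} {p} {q} {S} kp≡2q formula edge-sum =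
  *-cancelˡ-≡ c (q * N) 2 (+-cancelʳ-≡ _ _ _ (+-cancelʳ-≡ _ _ _ (begin
    2 * c + k * (N * N) + (2 + k) * (q * q + q)
      ≡⟨ cong₂ (λ x y → 2 * c + k * x + (2 + k) * (y + q)) (triangle-double N) (triangle-double q) ⟨
    2 * c + k * (T + T + N) + (2 + k) * (t + t + q + q)
      ≡⟨ regroup-cost c k T N (t + t + q + q) ⟩
    2 * (c + k * T) + k * N + (2 + k) * (t + t + q + q)
      ≡⟨ cong (λ x → 2 * x + k * N + (2 + k) * (t + t + q + q)) formula ⟩
    2 * ((2 + k) * S) + k * N + (2 + k) * (t + t + q + q)
      ≡⟨ regroup-edges k S t q N ⟩
    (2 + k) * (2 * (S + t + q)) + k * N
      ≡⟨ cong (λ x → (2 + k) * (2 * x) + k * N) edge-sum ⟩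
    (2 + k) * (2 * (q * N)) + k * N
      ≡⟨ eliminate-k*p ⟩
    2 * (q * N) + k * (N * N) + (2 + k) * (q * q + q) ∎)))
  where
  open ≡-Reasoning
  N = p + q
  T = triangle N
  t = triangle q
  regroup-cost : ∀ c k T N u →
    2 * c + k * (T + T + N) + (2 + k) * u ≡ 2 * (c + k * T) + k * N + (2 + k) * u
  regroup-cost = solve-∀
  regroup-edges : ∀ k S t q N →
    2 * ((2 + k) * S) + k * N + (2 + k) * (t + t + q + q) ≡ (2 + k) * (2 * (S + t + q)) + k * N
  regroup-edges = solve-∀
  -- A polynomial identity in k, p, q: the two paddings agree once k p = 2 q.
  kp-slack : ∀ k p q →
    (2 + k) * (2 * (q * (p + q))) + k * (p + q) + (p * (k * p) + (q + q))
      ≡ 2 * (q * (p + q)) + k * ((p + q) * (p + q)) + (2 + k) * (q * q + q)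
        + (p * (q + q) + k * p)
  kp-slack = solve-∀
  eliminate-k*p :
    (2 + k) * (2 * (q * N)) + k * N ≡ 2 * (q * N) + k * (N * N) + (2 + k) * (q * q + q)
  eliminate-k*p = +-cancelʳ-≡ (p * (k * p) + (q + q)) _ _
    (trans (kp-slack k p q) (cong (2 * (q * N) + k * (N * N) + (2 + k) * (q * q + q) +_)
                                  (cong₂ _+_ (cong (p *_) (sym kp≡2q)) kp≡2q)))

cost≤easy-cost : ∀ (G : Graph) {k} → (∀ v → degree G v ≡ k) → (x y : Seq G) →
  IsCSeq G x → IsEasy G x → IsCSeq G y → cost G y ≤ cost G x
cost≤easy-cost G {k} regular x y cseq-x easy-x cseq-y = +-cancelʳ-≤ (k * triangle N) _ _ (begin
  cost G y + k * triangle N       ≡⟨ cost-formula G y regular cseq-y ⟩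
  (2 + k) * edgePositionSum G y   ≤⟨ *-monoʳ-≤ (2 + k) edgePositionSum≤ ⟩
  (2 + k) * edgePositionSum G x   ≡⟨ cost-formula G x regular cseq-x ⟨
  cost G x + k * triangle N       ∎)
  where
  open ≤-Reasoning
  N = p G + q G
  edgePositionSum≤ : edgePositionSum G y ≤ edgePositionSum G x
  edgePositionSum≤ = +-cancelʳ-≤ (triangle (q G)) _ _ (+-cancelʳ-≤ (q G) (Sy + t) (Sx + t)
    (subst (Sy + t + q G ≤_) (sym (edgePositionSum-easy G x easy-x)) (edgePositionSum-bound G y)))
    where
    Sx = edgePositionSum G x
    Sy = edgePositionSum G y
    t  = triangle (q G)

theorem1 : (G : Graph) → Regular G → (x : Seq G) → IsCSeq G x → IsEasy G x →
    (cost G x ≡ q G * (p G + q G)) × IsMaxCost G (cost G x)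
theorem1 G (k , regular) x cseq easy =
  easy-cost , (x , cseq , refl) , λ y → cost≤easy-cost G regular x y cseq easy
  where
  easy-cost : cost G x ≡ q G * (p G + q G)
  easy-cost = easy-cost-value {k = k} {p G} {q G} (regular-handshake G regular)
                (cost-formula G x regular cseq) (edgePositionSum-easy G x easy)
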